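{- Let $V$ be a vertex set with $|V|=n\ge 2$ and let $G$ be the disjoint union of $n-1$ spanning arborescences $A_1,\dots,A_{n-1}$ on $V$. If the underlying undirected graph of $G$ is a tree (equivalently, there is a tree $T$ on $V$ such that every $A_i$ is an orientation of $T$), then $G$ has a rainbow spanning arborescence.
   Context: An arborescence is a connected digraph in which exactly one vertex (the root) has no incoming arc and every other vertex has exactly one incoming arc; it is spanning on $V$ if its vertex set is $V$. $G$ is the disjoint union of the arc sets $A_i$ (parallel arcs of different indices allowed); its underlying graph is obtained by ignoring orientations and identifying parallel edges. A subgraph $B$ of $G$ is rainbow if $|B\cap A_i|\le 1$ for all $i$. -}

module Defs where

open import Data.Nat using (ℕ; _≤_)
open import Data.Fin using (Fin)
open import Data.Fin.Properties using (_≟_)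
open import Data.Product using (_×_; _,_; Σ; ∃; proj₁; proj₂)
open import Data.Sum using (_⊎_)
open import Data.List using (List; []; _∷_; _++_; [_]; length; filter; map)
open import Data.List.Membership.Propositional using (_∈_)
open import Data.List.Relation.Unary.All using (All)
open import Data.List.Relation.Unary.Linked using (Linked)
open import Data.List.Relation.Unary.Unique.Propositional using (Unique)
open import Relation.Binary.PropositionalEquality using (_≡_; _≢_)
open import Relation.Binary.Construct.Closure.ReflexiveTransitive using (Star)
open import Relation.Nullary using (¬_)

Arc : ℕ → Set
Arc n = Fin n × Fin n

Digraph : ℕ → Set
Digraph n = List (Arc n)

indeg : ∀ {n} → Digraph n → Fin n → ℕ
indeg D v = length (filter (λ a → proj₂ a ≟ v) D)

UArc : ∀ {n} → Digraph n → Fin n → Fin n → Set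
UArc D u v = ((u , v) ∈ D) ⊎ ((v , u) ∈ D)

Connected : ∀ {n} → Digraph n → Set
Connected {n} D = (u v : Fin n) → Star (UArc D) u v

IsSpanningArborescence : ∀ {n} → Digraph n → Set
IsSpanningArborescence {n} D =
  Connected D × Σ (Fin n) (λ r → indeg D r ≡ 0 × ((v : Fin n) → v ≢ r → indeg D v ≡ 1))

-- G = disjoint union of the arc sets A i; a labelled arc (i , a) is an arc of G.
ColouredArc : ℕ → ℕ → Set
ColouredArc n k = Fin k × Arc n

IsSubgraph : ∀ {n k} → (Fin k → Digraph n) → List (ColouredArc n k) → Set
IsSubgraph A B = Unique B × All (λ c → proj₂ c ∈ A (proj₁ c)) B

countIndex : ∀ {n k} → Fin k → List (ColouredArc n k) → ℕ
countIndex i B = length (filter (λ c → proj₁ c ≟ i) B)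

IsRainbow : ∀ {n k} → List (ColouredArc n k) → Set
IsRainbow {k = k} B = (i : Fin k) → countIndex i B ≤ 1

-- Adjacency in the underlying simple undirected graph of G.
UAdj : ∀ {n k} → (Fin k → Digraph n) → Fin n → Fin n → Set
UAdj {k = k} A u v = ∃ λ (i : Fin k) → UArc (A i) u v

HasCycle : ∀ {n} → (Fin n → Fin n → Set) → Set
HasCycle {n} R =
  Σ (Fin n) λ v → Σ (List (Fin n)) λ ws →
    2 ≤ length ws × Unique (v ∷ ws) × Linked R (v ∷ ws ++ [ v ])

IsTree : ∀ {n} → (Fin n → Fin n → Set) → Set
IsTree {n} R = ((v : Fin n) → ¬ R v v) × ((u v : Fin n) → Star R u v) × ¬ HasCycle R

{-# OPTIONS --safe #-}
module Submission where

-- Induct on a vertex set S and a set K of unused colours with |S| ≤ |K| + 1 such that every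
-- colour of K, restricted to S, is still an arborescence. Pick i ∈ K, a leaf ℓ of A_i on S and
-- its parent p. In a forest, a walk between two neighbours must use the edge joining them;
-- applied to the walk from ℓ to a neighbour q of ℓ inside the arborescence A_i, this shows
-- that p is the only neighbour of ℓ in S, in every colour. Hence deleting ℓ keeps every A_j
-- an arborescence on S ∖ ℓ (rooted at p if ℓ was its root), and a rainbow arborescence on
-- S ∖ ℓ with colours from K ∖ i extends by the arc p → ℓ of colour i.

open import Defs
open import Data.Nat using (ℕ; suc; _≤_; _<_; _∸_; z≤n; s≤s)
open import Data.Nat.Properties
  using (≤-trans; ≤-antisym; ≤-reflexive; ≤-pred; <⇒≢; <⇒≱; ≤-<-trans; <-≤-trans)
open import Data.Fin using (Fin; zero)
open import Data.Fin.Properties using (_≟_)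
open import Data.Product using (_×_; _,_; Σ; ∃-syntax; proj₁; proj₂)
open import Data.Product.Properties using (≡-dec)
open import Data.Sum using (_⊎_; inj₁; inj₂; [_,_]′)
import Data.Sum as Sum
open import Data.Maybe using (just)
open import Data.Maybe.Relation.Binary.Connected as Maybe using (just)
open import Data.List using (List; []; _∷_; _++_; [_]; length; filter; map; allFin; last)
open import Data.List.Properties
  using (filter-some; filter-none; filter-notAll; length-tabulate)
open import Data.List.Membership.Propositional using (_∈_; _∉_; find; lose)
open import Data.List.Membership.Propositional.Properties
  using (∈-map⁺; ∈-map⁻; ∈-filter⁺; ∈-filter⁻; ∈-allFin)
open import Data.List.Membership.DecPropositional using (_∈?_)
open import Data.List.Relation.Unary.Any using (Any; here; there; any?)
import Data.List.Relation.Unary.Any as Any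
open import Data.List.Relation.Unary.All using (All; []; _∷_; all?)
import Data.List.Relation.Unary.All as All
open import Data.List.Relation.Unary.All.Properties using (¬Any⇒All¬; ¬All⇒Any¬)
open import Data.List.Relation.Unary.AllPairs using ([]; _∷_)
import Data.List.Relation.Unary.AllPairs as AllPairs
open import Data.List.Relation.Unary.Linked using (Linked; [-]; _∷_)
import Data.List.Relation.Unary.Linked as Linked
open import Data.List.Relation.Unary.Linked.Properties using (++⁺)
open import Data.List.Relation.Unary.Unique.Propositional using (Unique)
open import Data.List.Relation.Unary.Unique.Propositional.Properties
  using (filter⁺; map⁻; allFin⁺; Unique[x∷xs]⇒x∉xs)
open import Relation.Binary using (_⇒_)
open import Relation.Binary.PropositionalEquality
  using (_≡_; _≢_; refl; sym; trans; cong; subst)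
open import Relation.Binary.Construct.Closure.ReflexiveTransitive
  using (Star; ε; _◅_; _◅◅_; return)
import Relation.Binary.Construct.Closure.ReflexiveTransitive as Star
open import Relation.Nullary using (¬_; Dec; yes; no; ¬?; contradiction)
open import Function using (_∘_; id)

∉⇒All≢ : ∀ {X : Set} {x : X} {xs ys} → x ∉ ys → All (_∈ ys) xs → All (x ≢_) xs
∉⇒All≢ x∉ = All.map λ { x′∈ refl → x∉ x′∈ }

unsnoc : ∀ {X : Set} {T : X → X → Set} {x v} → Star T x v →
         x ≡ v ⊎ (∃[ q ] Star T x q × T q v)
unsnoc ε = inj₁ refl
unsnoc (t ◅ s) with unsnoc s
... | inj₁ refl = inj₂ (_ , ε , t)
... | inj₂ (q , s′ , t′) = inj₂ (q , t ◅ s′ , t′)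

module Counting {X : Set} {m : ℕ} (f : X → Fin m) where

  count : Fin m → List X → ℕ
  count c xs = length (filter (λ x → f x ≟ c) xs)

  count>0 : ∀ {c x xs} → x ∈ xs → f x ≡ c → 0 < count c xs
  count>0 x∈ fx≡c = filter-some _ (lose x∈ fx≡c)

  count≡0 : ∀ {c} xs → c ∉ map f xs → count c xs ≡ 0
  count≡0 xs c∉ = cong length (filter-none _ (All.tabulate λ x∈ fx≡c →
    c∉ (subst (_∈ map f xs) fx≡c (∈-map⁺ f x∈))))

  count≤1 : ∀ {c} xs → Unique (map f xs) → count c xs ≤ 1
  count≤1 [] _ = z≤n
  count≤1 {c} (x ∷ xs) u with f x ≟ c
  ... | yes refl = s≤s (≤-reflexive (count≡0 xs (Unique[x∷xs]⇒x∉xs u)))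
  ... | no _ = count≤1 xs (AllPairs.tail u)

  count≡1 : ∀ {c} xs → Unique (map f xs) → c ∈ map f xs → count c xs ≡ 1
  count≡1 xs u c∈ with x , x∈ , refl ← ∈-map⁻ f c∈ =
    ≤-antisym (count≤1 xs u) (count>0 x∈ refl)

  count≤1⇒≡ : ∀ {c x y xs} → count c xs ≤ 1 → x ∈ xs → y ∈ xs → f x ≡ c → f y ≡ c → x ≡ y
  count≤1⇒≡ {c} {xs = z ∷ xs} le x∈ y∈ fx fy with f z ≟ c | x∈ | y∈
  ... | _       | here refl | here refl = refl
  ... | yes _   | here refl | there y∈′ = contradiction (≤-pred le) (<⇒≱ (count>0 y∈′ fy))
  ... | yes _   | there x∈′ | _         = contradiction (≤-pred le) (<⇒≱ (count>0 x∈′ fx))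
  ... | no fz≢c | here refl | _         = contradiction fx fz≢c
  ... | no fz≢c | there _   | here refl = contradiction fy fz≢c
  ... | no _    | there x∈′ | there y∈′ = count≤1⇒≡ le x∈′ y∈′ fx fy

module _ {n : ℕ} where

  infixl 6 _∖_
  _∖_ : List (Fin n) → Fin n → List (Fin n)
  S ∖ x = filter (λ y → ¬? (y ≟ x)) S

  ∈-∖⁺ : ∀ {S x y} → y ∈ S → y ≢ x → y ∈ S ∖ x
  ∈-∖⁺ = ∈-filter⁺ _

  ∈-∖⁻ : ∀ S {x y} → y ∈ S ∖ x → y ∈ S × y ≢ x
  ∈-∖⁻ S = ∈-filter⁻ _ {xs = S}

  length-∖ : ∀ {S x} → x ∈ S → length (S ∖ x) < length S
  length-∖ x∈ = filter-notAll _ _ (Any.map (λ { refl x≢x → x≢x refl }) x∈)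

  another-vertex : ∀ {x y : Fin n} {S} → Unique (x ∷ y ∷ S) → ∀ r →
                   ∃[ z ] z ∈ x ∷ y ∷ S × z ≢ r
  another-vertex {x} ((x≢y ∷ _) ∷ _) r with x ≟ r
  ... | yes refl = _ , there (here refl) , x≢y ∘ sym
  ... | no x≢r = x , here refl , x≢r

  pigeonhole : ∀ {X : Set} (R : X → Fin n → Set) {xs ys} → Unique xs →
               (∀ {x} → x ∈ xs → ∃[ y ] y ∈ ys × R x y) →
               (∀ {x x′ y} → R x y → R x′ y → x ≡ x′) →
               length xs ≤ length ys
  pigeonhole R {[]} _ _ _ = z≤n
  pigeonhole R {x ∷ xs} {ys} (x∉xs ∷ u) image injective =
    let (y , y∈ , Rxy) = image (here refl)
        image′ : ∀ {x′} → x′ ∈ xs → ∃[ y′ ] y′ ∈ ys ∖ y × R x′ y′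
        image′ x′∈ =
          let (y′ , y′∈ , Rx′y′) = image (there x′∈)
              y′≢y : y′ ≢ y
              y′≢y y′≡y = All.lookup x∉xs x′∈ (injective Rxy (subst (R _) y′≡y Rx′y′))
          in y′ , ∈-∖⁺ y′∈ y′≢y , Rx′y′
    in ≤-<-trans (pigeonhole R u image′ injective) (length-∖ y∈)

  SimplePath : (Fin n → Fin n → Set) → Fin n → Fin n → Set
  SimplePath E u v = ∃[ ws ] Unique (u ∷ ws) × Linked E (u ∷ ws) × last (u ∷ ws) ≡ just v

  suffix : ∀ {E u w v} (P : SimplePath E w v) → u ∈ w ∷ proj₁ P → SimplePath E u v
  suffix P (here refl) = P
  suffix (_ ∷ ws , _ ∷ U , L , l) (there u∈) = suffix (ws , U , Linked.tail L , l) u∈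

  loop-erase : ∀ {E u v} → Star E u v → SimplePath E u v
  loop-erase ε = [] , [] ∷ [] , [-] , refl
  loop-erase {u = u} (e ◅ s) with P@(ws , U , L , l) ← loop-erase s | _∈?_ _≟_ u (_ ∷ ws)
  ... | yes u∈ = suffix P u∈
  ... | no u∉ = _ ∷ ws , ¬Any⇒All¬ _ u∉ ∷ U , e ∷ L , l

  module _ {R : Fin n → Fin n → Set} (loopless : ∀ v → ¬ R v v) (acyclic : ¬ HasCycle R) where

    walk-between-neighbours⇒edge : ∀ {E} → E ⇒ R → ∀ {u v} → Star E u v → R v u → E u v
    walk-between-neighbours⇒edge E⇒R {u} s Rvu with loop-erase s
    ... | [] , _ , _ , refl = contradiction Rvu (loopless u)
    ... | _ ∷ [] , _ , Euv ∷ [-] , refl = Euv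
    ... | ws@(_ ∷ _ ∷ _) , U , L , l = contradiction (u , ws , s≤s (s≤s z≤n) , U , cycle) acyclic
      where
        cycle : Linked R (u ∷ ws ++ [ u ])
        cycle = ++⁺ (Linked.map E⇒R L)
                    (subst (λ w → Maybe.Connected R w (just u)) (sym l) (just Rvu)) [-]

  ArcInto : Digraph n → List (Fin n) → Fin n → Fin n → Set
  ArcInto D S x y = (x , y) ∈ D × y ∈ S

  endpoint∈ : ∀ {D S x v} → x ∈ S → Star (ArcInto D S) x v → v ∈ S
  endpoint∈ x∈ ε = x∈
  endpoint∈ _ ((_ , y∈) ◅ s) = endpoint∈ y∈ s

  UniqueParents : Digraph n → Set
  UniqueParents D = ∀ {x z y} → (x , y) ∈ D → (z , y) ∈ D → x ≡ z

  Childless : Digraph n → List (Fin n) → Fin n → Set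
  Childless D S x = ∀ {y} → y ∈ S → (x , y) ∉ D

  record ArborescenceOn (D : Digraph n) (S : List (Fin n)) : Set where
    field
      root : Fin n
      root∈ : root ∈ S
      root-parentless : ∀ {x} → x ∈ S → (x , root) ∉ D
      reachable : ∀ {v} → v ∈ S → Star (ArcInto D S) root v

  record PendantArc (D : Digraph n) (S : List (Fin n)) : Set where
    field
      parent leaf : Fin n
      parent∈ : parent ∈ S
      leaf∈ : leaf ∈ S
      arc : (parent , leaf) ∈ D
      leaf-childless : Childless D S leaf

  has-child? : (D : Digraph n) (S : List (Fin n)) (x : Fin n) → Dec (Any (λ y → (x , y) ∈ D) S)
  has-child? D S x = any? (λ y → _∈?_ (≡-dec _≟_ _≟_) (x , y) D) S

  module _ {D : Digraph n} (uniq : UniqueParents D) where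

    -- If every vertex had a child in S, choosing one per vertex would inject S into S ∖ ρ.
    childless-exists : ∀ {S ρ} → Unique S → ρ ∈ S → (∀ {x} → x ∈ S → (x , ρ) ∉ D) →
                       ∃[ ℓ ] ℓ ∈ S × Childless D S ℓ
    childless-exists {S} {ρ} uS ρ∈ ρ-parentless with all? (has-child? D S) S
    ... | no ¬all =
      let (ℓ , ℓ∈ , childless) = find (¬All⇒Any¬ (has-child? D S) S ¬all)
      in ℓ , ℓ∈ , λ y∈ a → childless (lose y∈ a)
    ... | yes all =
      contradiction (pigeonhole (λ x y → (x , y) ∈ D) uS child uniq) (<⇒≱ (length-∖ ρ∈))
      where
        child : ∀ {x} → x ∈ S → ∃[ y ] y ∈ S ∖ ρ × (x , y) ∈ D
        child x∈ =
          let (y , y∈ , a) = find (All.lookup all x∈)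
          in y , ∈-∖⁺ y∈ (λ { refl → ρ-parentless x∈ a }) , a

    module _ {S} (T : ArborescenceOn D S) where
      open ArborescenceOn T

      pendant-arc-exists : Unique S → ∀ {z} → z ∈ S → z ≢ root → PendantArc D S
      pendant-arc-exists uS z∈ z≢root
        with ℓ , ℓ∈ , childless ← childless-exists uS root∈ root-parentless | unsnoc (reachable ℓ∈)
      ... | inj₂ (p , s , (pℓ , _)) = record
        { parent = p ; leaf = ℓ ; parent∈ = endpoint∈ root∈ s ; leaf∈ = ℓ∈
        ; arc = pℓ ; leaf-childless = childless }
      ... | inj₁ refl with reachable z∈
      ...   | ε = contradiction refl z≢root
      ...   | (a , y∈) ◅ _ = contradiction a (childless y∈)

      undirected-walk : ∀ {u v} → u ∈ S → v ∈ S → Star (UArc D) u v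
      undirected-walk u∈ v∈ =
        Star.reverse Sum.swap (undirected (reachable u∈)) ◅◅ undirected (reachable v∈)
        where
          undirected : ∀ {x y} → Star (ArcInto D S) x y → Star (UArc D) x y
          undirected = Star.map (inj₁ ∘ proj₁)

      leaf-neighbour≡parent : ∀ {R} → (∀ v → ¬ R v v) → ¬ HasCycle R → UArc D ⇒ R →
                              (P : PendantArc D S) → let open PendantArc P in
                              ∀ {q} → q ∈ S → R q leaf → q ≡ parent
      leaf-neighbour≡parent loopless acyclic D⇒R P q∈ Rqℓ =
        [ (λ ℓq → contradiction ℓq (leaf-childless q∈)) , (λ qℓ → uniq qℓ arc) ]′
          (walk-between-neighbours⇒edge loopless acyclic D⇒R (undirected-walk leaf∈ q∈) Rqℓ)
        where open PendantArc P

    module _ {S ℓ p} (p∈ : p ∈ S) (p≢ℓ : p ≢ ℓ)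
             (only-neighbour : ∀ {q} → q ∈ S → UArc D ℓ q → q ≡ p) where

      -- A walk that enters ℓ comes from p and goes back to p, so the detour can be cut out.
      mutual
        bypass : ∀ {x v} → x ∈ S → x ≢ ℓ → Star (ArcInto D S) x v → v ≢ ℓ →
                 Star (ArcInto D (S ∖ ℓ)) x v
        bypass _ _ ε _ = ε
        bypass x∈ x≢ℓ (_◅_ {j = y} (a , y∈) s) v≢ℓ with y ≟ ℓ
        ... | no y≢ℓ = (a , ∈-∖⁺ y∈ y≢ℓ) ◅ bypass y∈ y≢ℓ s v≢ℓ
        ... | yes refl with refl ← only-neighbour x∈ (inj₂ a) = bypass-from-ℓ s v≢ℓ

        bypass-from-ℓ : ∀ {v} → Star (ArcInto D S) ℓ v → v ≢ ℓ → Star (ArcInto D (S ∖ ℓ)) p v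
        bypass-from-ℓ ε v≢ℓ = contradiction refl v≢ℓ
        bypass-from-ℓ ((a , y∈) ◅ s) v≢ℓ with refl ← only-neighbour y∈ (inj₁ a) =
          bypass p∈ p≢ℓ s v≢ℓ

      walk⇒arc : Star (ArcInto D S) ℓ p → (ℓ , p) ∈ D
      walk⇒arc ε = contradiction refl p≢ℓ
      walk⇒arc ((a , y∈) ◅ _) with refl ← only-neighbour y∈ (inj₁ a) = a

      delete-leaf : ArborescenceOn D S → ArborescenceOn D (S ∖ ℓ)
      delete-leaf T with ArborescenceOn.root T ≟ ℓ
      ... | no root≢ℓ = record
        { root = root
        ; root∈ = ∈-∖⁺ root∈ root≢ℓ
        ; root-parentless = root-parentless ∘ proj₁ ∘ ∈-∖⁻ S
        ; reachable = λ v∈ → let (v∈S , v≢ℓ) = ∈-∖⁻ S v∈ in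
            bypass root∈ root≢ℓ (reachable v∈S) v≢ℓ
        } where open ArborescenceOn T
      ... | yes refl = record
        { root = p
        ; root∈ = ∈-∖⁺ p∈ p≢ℓ
        ; root-parentless = λ x∈ xp → proj₂ (∈-∖⁻ S x∈) (uniq xp (walk⇒arc (reachable p∈)))
        ; reachable = λ v∈ → let (v∈S , v≢ℓ) = ∈-∖⁻ S v∈ in bypass-from-ℓ (reachable v∈S) v≢ℓ
        } where open ArborescenceOn T

module _ {n : ℕ} {D : Digraph n} (T : IsSpanningArborescence D) where
  open Counting {Arc n} proj₂

  private
    r : Fin n
    r = proj₁ (proj₂ T)

    indeg-root : indeg D r ≡ 0
    indeg-root = proj₁ (proj₂ (proj₂ T))

    indeg≤1 : ∀ y → indeg D y ≤ 1
    indeg≤1 y with y ≟ r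
    ... | yes refl = ≤-trans (≤-reflexive indeg-root) z≤n
    ... | no y≢r = ≤-reflexive (proj₂ (proj₂ (proj₂ T)) y y≢r)

  spanning⇒uniqueParents : UniqueParents D
  spanning⇒uniqueParents a b = cong proj₁ (count≤1⇒≡ (indeg≤1 _) a b refl refl)

  spanning⇒arborescenceOn : ArborescenceOn D (allFin n)
  spanning⇒arborescenceOn = record
    { root = r
    ; root∈ = ∈-allFin r
    ; root-parentless = parentless
    ; reachable = λ {v} _ → orient ε (proj₁ T r v)
    }
    where
      parentless : ∀ {x} → x ∈ allFin n → (x , r) ∉ D
      parentless _ a = <⇒≢ (count>0 a refl) (sym indeg-root)

      -- Traversing an arc backwards retraces the last arc of the path from r, as parents are unique.
      orient : ∀ {u v} → Star (ArcInto D (allFin n)) r u → Star (UArc D) u v →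
               Star (ArcInto D (allFin n)) r v
      orient s ε = s
      orient s (inj₁ a ◅ w) = orient (s ◅◅ return (a , ∈-allFin _)) w
      orient s (inj₂ a ◅ w) with unsnoc s
      ... | inj₁ refl = contradiction a (parentless (∈-allFin _))
      ... | inj₂ (_ , s′ , (a′ , _)) with refl ← spanning⇒uniqueParents a′ a = orient s′ w

module Rainbow {n k : ℕ} (A : Fin k → Digraph n) where

  heads : List (ColouredArc n k) → List (Fin n)
  heads B = map proj₂ (map proj₂ B)

  record RainbowArborescenceOn (S : List (Fin n)) (K : List (Fin k))
                               (B : List (ColouredArc n k)) : Set where
    field
      root : Fin n
      root∈ : root ∈ S
      arcs⊆A : All (λ (i , a) → a ∈ A i) B
      colours⊆K : All (_∈ K) (map proj₁ B)
      heads⊆S : All (_∈ S) (heads B)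
      colours-unique : Unique (map proj₁ B)
      heads-unique : Unique (heads B)
      root∉heads : root ∉ heads B
      heads-complete : ∀ {v} → v ∈ S → v ≢ root → v ∈ heads B
      connected : ∀ {v} → v ∈ S → Star (UArc (map proj₂ B)) root v

  rainbow-singleton : ∀ {x K} → RainbowArborescenceOn [ x ] K []
  rainbow-singleton {x} = record
    { root = x
    ; root∈ = here refl
    ; arcs⊆A = []
    ; colours⊆K = []
    ; heads⊆S = []
    ; colours-unique = []
    ; heads-unique = []
    ; root∉heads = λ ()
    ; heads-complete = λ { (here refl) x≢x → contradiction refl x≢x }
    ; connected = λ { (here refl) → ε }
    }

  extend : ∀ {S K B i ℓ p} → i ∉ K → (p , ℓ) ∈ A i → ℓ ∈ S → p ∈ S ∖ ℓ →
           RainbowArborescenceOn (S ∖ ℓ) K B →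
           RainbowArborescenceOn S (i ∷ K) ((i , p , ℓ) ∷ B)
  extend {S} {K} {B} {i} {ℓ} {p} i∉K pℓ ℓ∈ p∈ R = record
    { root = root
    ; root∈ = proj₁ (∈-∖⁻ S root∈)
    ; arcs⊆A = pℓ ∷ arcs⊆A
    ; colours⊆K = here refl ∷ All.map there colours⊆K
    ; heads⊆S = ℓ∈ ∷ All.map (proj₁ ∘ ∈-∖⁻ S) heads⊆S
    ; colours-unique = ∉⇒All≢ i∉K colours⊆K ∷ colours-unique
    ; heads-unique = ∉⇒All≢ (λ ℓ∈′ → proj₂ (∈-∖⁻ S ℓ∈′) refl) heads⊆S ∷ heads-unique
    ; root∉heads = λ { (here refl) → proj₂ (∈-∖⁻ S root∈) refl ; (there r∈) → root∉heads r∈ }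
    ; heads-complete = heads-complete′
    ; connected = connected′
    }
    where
      open RainbowArborescenceOn R

      heads-complete′ : ∀ {v} → v ∈ S → v ≢ root → v ∈ ℓ ∷ heads B
      heads-complete′ {v} v∈ v≢root with v ≟ ℓ
      ... | yes refl = here refl
      ... | no v≢ℓ = there (heads-complete (∈-∖⁺ v∈ v≢ℓ) v≢root)

      weaken : ∀ {u v} → Star (UArc (map proj₂ B)) u v →
               Star (UArc ((p , ℓ) ∷ map proj₂ B)) u v
      weaken = Star.map (Sum.map there there)

      connected′ : ∀ {v} → v ∈ S → Star (UArc ((p , ℓ) ∷ map proj₂ B)) root v
      connected′ {v} v∈ with v ≟ ℓ
      ... | yes refl = weaken (connected p∈) ◅◅ return (inj₁ (here refl))
      ... | no v≢ℓ = weaken (connected (∈-∖⁺ v∈ v≢ℓ))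

  rainbow⇒spanning : ∀ {K B} → RainbowArborescenceOn (allFin n) K B →
                     IsSubgraph A B × IsRainbow B × IsSpanningArborescence (map proj₂ B)
  rainbow⇒spanning {B = B} R =
    (map⁻ colours-unique , arcs⊆A) ,
    (λ i → Counting.count≤1 proj₁ B colours-unique) ,
    (λ u v → Star.reverse Sum.swap (connected (∈-allFin u)) ◅◅ connected (∈-allFin v)) ,
    root ,
    Counting.count≡0 proj₂ (map proj₂ B) root∉heads ,
    (λ v v≢root →
      Counting.count≡1 proj₂ (map proj₂ B) heads-unique (heads-complete (∈-allFin v) v≢root))
    where open RainbowArborescenceOn R

  record Stage (S : List (Fin n)) (K : List (Fin k)) : Set where
    field
      S-unique : Unique S
      K-unique : Unique K
      size : length S ≤ suc (length K)
      inhabited : ∃[ x ] x ∈ S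
      arborescence : ∀ {j} → j ∈ K → ArborescenceOn (A j) S

  module Construction (uniq : ∀ j → UniqueParents (A j))
                      (loopless : ∀ v → ¬ UAdj A v v) (acyclic : ¬ HasCycle (UAdj A)) where

    pendant-arc : ∀ {i K x y S₀} → let S = x ∷ y ∷ S₀ in Stage S (i ∷ K) → PendantArc (A i) S
    pendant-arc st =
      let (_ , z∈ , z≢root) = another-vertex S-unique (ArborescenceOn.root T)
      in pendant-arc-exists (uniq _) T S-unique z∈ z≢root
      where
        open Stage st
        T = arborescence (here refl)

    module LeafDeletion {i K S} (st : Stage S (i ∷ K)) (P : PendantArc (A i) S) where
      open Stage st
      open PendantArc P

      parent≢leaf : parent ≢ leaf
      parent≢leaf refl = leaf-childless leaf∈ arc

      only-neighbour : ∀ {j q} → q ∈ S → UArc (A j) leaf q → q ≡ parent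
      only-neighbour {j} q∈ e = leaf-neighbour≡parent (uniq i) (arborescence (here refl))
                                  loopless acyclic (i ,_) P q∈ (j , Sum.swap e)

      smaller-stage : Stage (S ∖ leaf) K
      smaller-stage = record
        { S-unique = filter⁺ _ S-unique
        ; K-unique = AllPairs.tail K-unique
        ; size = ≤-pred (<-≤-trans (length-∖ leaf∈) size)
        ; inhabited = parent , ∈-∖⁺ parent∈ parent≢leaf
        ; arborescence = λ j∈ →
            delete-leaf (uniq _) parent∈ parent≢leaf only-neighbour (arborescence (there j∈))
        }

      extend-by-leaf : ∀ {B} → RainbowArborescenceOn (S ∖ leaf) K B →
                       RainbowArborescenceOn S (i ∷ K) ((i , parent , leaf) ∷ B)
      extend-by-leaf = extend (Unique[x∷xs]⇒x∉xs K-unique) arc leaf∈ (∈-∖⁺ parent∈ parent≢leaf)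

    build : ∀ K {S} → Stage S K → ∃[ B ] RainbowArborescenceOn S K B
    build _ {[]} st = contradiction (proj₂ (Stage.inhabited st)) λ ()
    build _ {_ ∷ []} _ = [] , rainbow-singleton
    build [] {_ ∷ _ ∷ _} st = contradiction (Stage.size st) λ { (s≤s ()) }
    build (i ∷ K) {_ ∷ _ ∷ _} st =
      let P = pendant-arc st
          (B , R) = build K (LeafDeletion.smaller-stage st P)
      in (i , PendantArc.parent P , PendantArc.leaf P) ∷ B , LeafDeletion.extend-by-leaf st P R

theorem3p7 : (n : ℕ) → 2 ≤ n → (A : Fin (n ∸ 1) → Digraph n) →
    ((i : Fin (n ∸ 1)) → IsSpanningArborescence (A i)) →
    IsTree (UAdj A) →
    Σ (List (ColouredArc n (n ∸ 1))) (λ B →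
      IsSubgraph A B × IsRainbow B × IsSpanningArborescence (map proj₂ B))
theorem3p7 (suc (suc m)) (s≤s (s≤s z≤n)) A arb (loopless , _ , acyclic) =
  let (B , R) = build (allFin (suc m)) initial in B , rainbow⇒spanning R
  where
    open Rainbow A
    open Construction (spanning⇒uniqueParents ∘ arb) loopless acyclic

    length-allFin : ∀ l → length (allFin l) ≡ l
    length-allFin l = length-tabulate {n = l} id

    initial : Stage (allFin (suc (suc m))) (allFin (suc m))
    initial = record
      { S-unique = allFin⁺ _
      ; K-unique = allFin⁺ _
      ; size = ≤-reflexive
          (trans (length-allFin (suc (suc m))) (cong suc (sym (length-allFin (suc m)))))
      ; inhabited = zero , ∈-allFin zero
      ; arborescence = λ {j} _ → spanning⇒arborescenceOn (arb j)
      }
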